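{- There exists a function $f(n,w)$ such that for all positive integers $n$ and $w$ the following holds. If $G$ is a connected graph and $(T,\mathcal{Y})$ is a lean tree-decomposition of $G$ of width at most $w$ and $T$ contains a path $P$ of length at least $f(n,w)$, then $V(P)$ contains a set $\{t_1,\dots,t_n\}$ of interior vertices of $P$, occurring along $P$ in this order, such that: (i) for some positive integer $s\leq w+1$, $|Y_{t_i}|=s$ for all $i\in\{1,\dots,n\}$, and $|Y_t|\geq s$ for every vertex $t$ of $P$ between $t_1$ and $t_n$; and (ii) there is a set $U\subseteq V(G)$ with $Y_{t_i}\cap Y_{t_j}=U$ for all distinct $i,j\in\{1,\dots,n\}$.
   Context: Graphs are finite and loopless but may have multiple edges. A tree-decomposition of $G$ is a pair $(T,\mathcal{Y})$, $T$ a tree, $\mathcal{Y}=\{Y_t\}_{t\in V(T)}$ subsets of $V(G)$, such that (W1) $\bigcup_t Y_t=V(G)$ and every edge has both ends in some $Y_t$; (W2) if $t'$ is on the $T$-path between $t$ and $t''$ then $Y_t\cap Y_{t''}\subseteq Y_{t'}$. Width is $\max_t(|Y_t|-1)$. It is lean if moreover: (W3) for every two vertices $t,t'$ of $T$ and every positive integer $k$, either there are $k$ vertex-disjoint paths in $G$ between $Y_t$ and $Y_{t'}$, or some vertex $t''$ on the $T$-path between $t$ and $t'$ has $|Y_{t''}|<k$; (W4) distinct vertices of $T$ have distinct bags; (W5) for every $t_0\in V(T)$ and every component $B$ of $T-t_0$, $\bigcup_{t\in V(B)}Y_t\setminus Y_{t_0}\neq\emptyset$. Length of a path is its number of edges.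 -}

module Defs where

open import Data.Nat using (ℕ; zero; suc; _≤_; _<_; _∸_)
open import Data.Fin using (Fin; toℕ)
open import Data.Fin.Subset using (Subset; _∈_; _∉_; _∩_; _⊆_; ∣_∣)
open import Data.List using (List; []; _∷_; length; lookup)
open import Data.List.Relation.Unary.Linked using (Linked)
open import Data.List.Relation.Unary.Unique.Propositional using (Unique)
open import Data.List.Relation.Unary.All using (All)
open import Data.List.Membership.Propositional using () renaming (_∈_ to _∈ₗ_)
open import Data.Product using (Σ; ∃; _×_; _,_; proj₁; proj₂)
open import Data.Sum using (_⊎_)
open import Relation.Binary.PropositionalEquality using (_≡_; _≢_)
open import Relation.Nullary using (¬_)

record Graph : Set where
  field
    nV : ℕ
    nE : ℕ
    ends : Fin nE → Fin nV × Fin nV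
    loopless : ∀ e → proj₁ (ends e) ≢ proj₂ (ends e)

open Graph public

Vtx : Graph → Set
Vtx G = Fin (nV G)

Adj : (G : Graph) → Vtx G → Vtx G → Set
Adj G u v = ∃ λ e → (ends G e ≡ (u , v)) ⊎ (ends G e ≡ (v , u))

lastOf : {A : Set} → A → List A → A
lastOf a [] = a
lastOf a (b ∷ bs) = lastOf b bs

record Path (G : Graph) : Set where
  field
    first : Vtx G
    rest  : List (Vtx G)
    linked : Linked (Adj G) (first ∷ rest)
    unique : Unique (first ∷ rest)

open Path public

verts : {G : Graph} → Path G → List (Vtx G)
verts p = first p ∷ rest p

final : {G : Graph} → Path G → Vtx G
final p = lastOf (first p) (rest p)

pathLength : {G : Graph} → Path G → ℕ
pathLength p = length (rest p)

PathFromTo : (G : Graph) → Path G → Vtx G → Vtx G → Set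
PathFromTo G p u v = (first p ≡ u) × (final p ≡ v)

Connected : Graph → Set
Connected G = Vtx G × (∀ u v → ∃ λ (p : Path G) → PathFromTo G p u v)

-- a cycle of length ≥ 3
HasLongCycle : Graph → Set
HasLongCycle G = ∃ λ (p : Path G) → (2 ≤ pathLength p) × Adj G (final p) (first p)

-- a cycle of length 2 (two parallel edges)
HasParallelEdges : Graph → Set
HasParallelEdges G = ∃ λ e → ∃ λ e' → (e ≢ e') ×
  ((ends G e ≡ ends G e') ⊎ (ends G e ≡ (proj₂ (ends G e') , proj₁ (ends G e'))))

Acyclic : Graph → Set
Acyclic G = ¬ HasLongCycle G × ¬ HasParallelEdges G

IsTree : Graph → Set
IsTree T = Connected T × Acyclic T

OnPath : (T : Graph) → Vtx T → Vtx T → Vtx T → Set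
OnPath T t t' t'' = ∃ λ (p : Path T) → PathFromTo T p t t'' × (t' ∈ₗ verts p)

Bags : Graph → Graph → Set
Bags G T = Vtx T → Subset (nV G)

W1 : (G T : Graph) → Bags G T → Set
W1 G T Y = (∀ v → ∃ λ t → v ∈ Y t) ×
           (∀ e → ∃ λ t → (proj₁ (ends G e) ∈ Y t) × (proj₂ (ends G e) ∈ Y t))

W2 : (G T : Graph) → Bags G T → Set
W2 G T Y = ∀ t t' t'' → OnPath T t t' t'' → (Y t ∩ Y t'') ⊆ Y t'

IsTreeDecomposition : (G T : Graph) → Bags G T → Set
IsTreeDecomposition G T Y = IsTree T × W1 G T Y × W2 G T Y

WidthAtMost : (G T : Graph) → Bags G T → ℕ → Set
WidthAtMost G T Y w = ∀ t → ∣ Y t ∣ ≤ suc w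

DisjointPaths : (G : Graph) → Subset (nV G) → Subset (nV G) → ℕ → Set
DisjointPaths G A B k =
  Σ (Fin k → Path G) λ ps →
    (∀ i → (first (ps i) ∈ A) × (final (ps i) ∈ B)) ×
    (∀ i j → i ≢ j → ∀ x → x ∈ₗ verts (ps i) → ¬ (x ∈ₗ verts (ps j)))

W3 : (G T : Graph) → Bags G T → Set
W3 G T Y = ∀ t t' k → 1 ≤ k →
  DisjointPaths G (Y t) (Y t') k ⊎ (∃ λ t'' → OnPath T t t'' t' × (∣ Y t'' ∣ < k))

W4 : (G T : Graph) → Bags G T → Set
W4 G T Y = ∀ t t' → t ≢ t' → Y t ≢ Y t'

SameComponentAvoiding : (T : Graph) → Vtx T → Vtx T → Vtx T → Set
SameComponentAvoiding T t0 t t1 =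
  ∃ λ (p : Path T) → PathFromTo T p t t1 × All (λ x → x ≢ t0) (verts p)

-- every component B of T - t0 (represented by any of its vertices t)
-- has a vertex t1 whose bag is not contained in Y t0
W5 : (G T : Graph) → Bags G T → Set
W5 G T Y = ∀ t0 t → t ≢ t0 →
  ∃ λ t1 → SameComponentAvoiding T t0 t t1 × (∃ λ x → (x ∈ Y t1) × (x ∉ Y t0))

IsLean : (G T : Graph) → Bags G T → Set
IsLean G T Y = IsTreeDecomposition G T Y × W3 G T Y × W4 G T Y × W5 G T Y

at : {T : Graph} (P : Path T) → Fin (length (verts P)) → Vtx T
at P m = lookup (verts P) m

-- Conclusion of Lemma 5.4 for path P, bags Y, parameters n, w.
-- σ gives the positions of t_1,…,t_n along P.
Lemma5p4Conclusion : (G T : Graph) → Bags G T → (P : Path T) → ℕ → ℕ → Set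
Lemma5p4Conclusion G T Y P n w =
  Σ (Fin n → Fin (length (verts P))) λ σ →
    (∀ i j → toℕ i < toℕ j → toℕ (σ i) < toℕ (σ j)) ×
    (∀ i → (0 < toℕ (σ i)) × (toℕ (σ i) < pathLength P)) ×
    (∃ λ s → (1 ≤ s) × (s ≤ suc w) ×
       (∀ i → ∣ Y (at P (σ i)) ∣ ≡ s) ×
       (∀ m → (∃ λ i → ∃ λ j → (toℕ (σ i) ≤ toℕ m) × (toℕ m ≤ toℕ (σ j))) →
              s ≤ ∣ Y (at P m) ∣)) ×
    (∃ λ (U : Subset (nV G)) → ∀ i j → i ≢ j → (Y (at P (σ i)) ∩ Y (at P (σ j))) ≡ U)

{-# OPTIONS --safe #-}
-- Only the sizes of the bags along P matter, together with W4 to rule out the level s = 0.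
-- Let S = w + 1 bound the bag sizes and let R be the Erdős–Rado bound guaranteeing a
-- sunflower with n + 1 petals among R sets of size at most S.  Take a window of R^d
-- consecutive positions of P in which every bag has at least b elements, where b + d > S,
-- and cut it into R blocks of length R^(d-1).  If some block contains no bag of size
-- exactly b, every bag in it has at least b + 1 elements and we recurse into that block.
-- Otherwise one size-b position per block gives R increasing positions whose bags have
-- equal size s = b, with no smaller bag between them, and n + 1 of these bags form a
-- sunflower.  Starting with b = 0 and d = S + 1 on the window [1, 1 + R^(S+1)) of interior
-- vertices gives f(n, w) = 1 + R^(w+2).  Two distinct vertices of P with empty bags would
-- contradict W4; having n + 1 ≥ 2 positions therefore forces s ≥ 1.
module Submission where

open import Defs

open import Data.Bool using (true; false)
open import Data.Empty using (⊥-elim)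
open import Data.Fin using (Fin; toℕ; fromℕ<; inject≤)
open import Data.Fin.Properties using (toℕ<n; toℕ-fromℕ<; fromℕ<-toℕ; toℕ-inject≤; toℕ-injective)
  renaming (_≟_ to _≟ᶠ_)
open import Data.Fin.Subset using (Subset; _∈_; _∉_; _∩_; _∪_; _⊆_; _-_; ∁; ∣_∣; ⊥; ⁅_⁆)
open import Data.Fin.Subset.Properties
  using ( _∈?_; nonempty?; Empty-unique; ⊆-antisym; ⊥⊆; ∣⊥∣≡0; p⊂q⇒∣p∣<∣q∣; x∈p⇒∣p-x∣<∣p∣
        ; x∈p∧x≢y⇒x∈p-y; p─q⊆p; p∩q⊆q; ∣p∩q∣≤∣p∣; x∈p∩q⁺; x∈p∩q⁻; ∩-comm
        ; p⊆p∪q; x∈p∪q⁺; x∈p∪q⁻; x∈⁅x⁆; x∈⁅y⁆⇒x≡y; x∈∁p⇒x∉p; x∉p⇒x∈∁p )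
open import Data.List using (List; []; _∷_; length; lookup; filter)
open import Data.List.Membership.Propositional.Properties using (∈-lookup)
open import Data.List.Relation.Binary.Sublist.Propositional
  using ([]; _∷_; _∷ʳ_; minimum; ⊆-refl; ⊆-trans) renaming (_⊆_ to _⊆ₗ_)
open import Data.List.Relation.Binary.Sublist.Propositional.Properties using (All-resp-⊆; filter-⊆)
open import Data.List.Relation.Unary.All as All using (All; []; _∷_; universal)
open import Data.List.Relation.Unary.All.Properties using (all-filter; filter⁺)
open import Data.List.Relation.Unary.AllPairs using (AllPairs; []; _∷_)
open import Data.Nat using (ℕ; zero; suc; _+_; _*_; _^_; _≤_; _<_; z≤n; s≤s; s≤s⁻¹; z<s; _≟_)
open import Data.Nat.Properties
open import Data.Product using (Σ; ∃-syntax; _×_; _,_; proj₁; proj₂; map₁; uncurry)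
open import Data.Sum using (_⊎_; inj₁; inj₂; [_,_]′)
open import Function using (_∘_; id)
open import Relation.Binary.Definitions using (Symmetric; tri<; tri≈; tri>)
open import Relation.Binary.PropositionalEquality
  using (_≡_; _≢_; refl; sym; trans; cong; cong₂; subst; subst₂)
open import Relation.Nullary using (¬_; yes; no; does; contradiction)
open import Relation.Nullary.Decidable using (_×-dec_)
open import Relation.Unary using (Decidable)
open import Relation.Unary.Properties using (∁?)

module _ {A : Set} {R : A → A → Set} where

  AllPairs-resp-⊆ : ∀ {xs ys} → xs ⊆ₗ ys → AllPairs R ys → AllPairs R xs
  AllPairs-resp-⊆ []             []         = []
  AllPairs-resp-⊆ (_ ∷ʳ xs⊆ys)   (_ ∷ Rys)  = AllPairs-resp-⊆ xs⊆ys Rys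
  AllPairs-resp-⊆ (refl ∷ xs⊆ys) (Ry ∷ Rys) = All-resp-⊆ xs⊆ys Ry ∷ AllPairs-resp-⊆ xs⊆ys Rys

  AllPairs-lookup : ∀ {xs} → AllPairs R xs →
                    ∀ i j → toℕ i < toℕ j → R (lookup xs i) (lookup xs j)
  AllPairs-lookup (Rx ∷ _)   Fin.zero    (Fin.suc j) _         = All.lookup Rx (∈-lookup j)
  AllPairs-lookup (_  ∷ Rxs) (Fin.suc i) (Fin.suc j) (s≤s i<j) = AllPairs-lookup Rxs i j i<j

  AllPairs-lookup-≢ : Symmetric R → ∀ {xs} → AllPairs R xs →
                      ∀ i j → i ≢ j → R (lookup xs i) (lookup xs j)
  AllPairs-lookup-≢ R-sym Rxs i j i≢j with <-cmp (toℕ i) (toℕ j)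
  ... | tri< i<j _ _ = AllPairs-lookup Rxs i j i<j
  ... | tri≈ _ i≡j _ = contradiction (toℕ-injective i≡j) i≢j
  ... | tri> _ _ j<i = R-sym (AllPairs-lookup Rxs j i j<i)

length-filter-∁ : ∀ {A : Set} {P : A → Set} (P? : Decidable P) xs →
                  length (filter P? xs) + length (filter (∁? P?) xs) ≡ length xs
length-filter-∁ P? [] = refl
length-filter-∁ P? (x ∷ xs) with does (P? x)
... | true  = cong suc (length-filter-∁ P? xs)
... | false = trans (+-suc _ _) (cong suc (length-filter-∁ P? xs))

m+n≤o≤p+m⇒n≤p : ∀ m {n o p} → m + n ≤ o → o ≤ p + m → n ≤ p
m+n≤o≤p+m⇒n≤p m {n} {o} {p} m+n≤o o≤p+m =
  +-cancelˡ-≤ m n p (≤-trans m+n≤o (≤-trans o≤p+m (≤-reflexive (+-comm p m))))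

module _ {V : ℕ} where

  ∣p∣≡0⇒p≡⊥ : {p : Subset V} → ∣ p ∣ ≡ 0 → p ≡ ⊥
  ∣p∣≡0⇒p≡⊥ {p} ∣p∣≡0 = Empty-unique λ (x , x∈p) → n≮0 (subst (∣ p - x ∣ <_) ∣p∣≡0 (x∈p⇒∣p-x∣<∣p∣ x∈p))

  Disjoint : Subset V → Subset V → Set
  Disjoint p q = ∀ x → x ∈ p → x ∉ q

  Disjoint-remove⁻ : ∀ {x} {p q : Subset V} → x ∉ q → Disjoint (p - x) q → Disjoint p q
  Disjoint-remove⁻ {x} x∉q disjoint y y∈p with y ≟ᶠ x
  ... | yes refl = x∉q
  ... | no  y≢x  = disjoint y (x∈p∧x≢y⇒x∈p-y y∈p y≢x)

  p∩q≡c : {c p q : Subset V} → c ⊆ p → c ⊆ q → Disjoint (p ∩ ∁ c) q → p ∩ q ≡ c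
  p∩q≡c {c} {p} {q} c⊆p c⊆q disjoint = ⊆-antisym p∩q⊆c (λ y∈c → x∈p∩q⁺ (c⊆p y∈c , c⊆q y∈c))
    where
    p∩q⊆c : p ∩ q ⊆ c
    p∩q⊆c {y} y∈p∩q with x∈p∩q⁻ p q y∈p∩q | y ∈? c
    ... | _          | yes y∈c = y∈c
    ... | y∈p , y∈q | no  y∉c = contradiction y∈q (disjoint y (x∈p∩q⁺ (y∈p , x∉p⇒x∈∁p y∉c)))

  c∪⁅x⁆⊆p : ∀ {x} {c p : Subset V} → c ⊆ p → x ∈ p → c ∪ ⁅ x ⁆ ⊆ p
  c∪⁅x⁆⊆p {x} {c} {p} c⊆p x∈p {y} y∈ =
    [ c⊆p , (λ y∈⁅x⁆ → subst (_∈ p) (sym (x∈⁅y⁆⇒x≡y x y∈⁅x⁆)) x∈p) ]′ (x∈p∪q⁻ c ⁅ x ⁆ y∈)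

  ∣p∣<∣p∪⁅x⁆∣ : ∀ {x} {p : Subset V} → x ∉ p → ∣ p ∣ < ∣ p ∪ ⁅ x ⁆ ∣
  ∣p∣<∣p∪⁅x⁆∣ {x} {p} x∉p = p⊂q⇒∣p∣<∣q∣ (p⊆p∪q {p = p} ⁅ x ⁆ , x , x∈p∪q⁺ (inj₂ (x∈⁅x⁆ x)) , x∉p)

-- For sets of size at most S containing a common core C with S ≤ |C| + t: either n of them
-- pairwise meet exactly in C, or heavyThreshold S n t of them share a point x ∉ C, and we
-- recurse on those with the core C ∪ {x} and t − 1.
heavyThreshold : (S n t : ℕ) → ℕ
sunflowerBound : (S n t : ℕ) → ℕ

sunflowerBound S n t = n * (1 + S * heavyThreshold S n t)

heavyThreshold S n zero    = 1
heavyThreshold S n (suc t) = sunflowerBound S n t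

module Sunflowers {I : Set} {V : ℕ} (F : I → Subset V) (S : ℕ) (∣F∣≤S : ∀ i → ∣ F i ∣ ≤ S) where

  IsSunflower : Subset V → List I → Set
  IsSunflower core = AllPairs (λ i j → F i ∩ F j ≡ core)

  HasSunflower : ℕ → List I → Set
  HasSunflower n xs = ∃[ ys ] ys ⊆ₗ xs × n ≤ length ys × ∃[ core ] IsSunflower core ys

  record Heavy (E : Subset V) (M : ℕ) (xs : List I) : Set where
    constructor heavy
    field
      point     : Fin V
      point∈E   : point ∈ E
      members   : List I
      members⊆  : members ⊆ₗ xs
      many      : M ≤ length members
      contained : All (λ i → point ∈ F i) members

  contains? : ∀ x → Decidable (λ i → x ∈ F i)
  contains? x i = x ∈? F i

  Heavy-mono : ∀ {E E′ M xs ys} → E ⊆ E′ → xs ⊆ₗ ys → Heavy E M xs → Heavy E′ M ys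
  Heavy-mono E⊆E′ xs⊆ys (heavy x x∈E zs zs⊆xs many x∈zs) =
    heavy x (E⊆E′ x∈E) zs (⊆-trans zs⊆xs xs⊆ys) many x∈zs

  heavy-or-avoiding : ∀ M c E xs → ∣ E ∣ ≤ c →
                      Heavy E M xs ⊎
                      ∃[ ys ] ys ⊆ₗ xs × length xs ≤ length ys + c * M × All (Disjoint E ∘ F) ys
  heavy-or-avoiding M c E xs ∣E∣≤c with nonempty? E
  heavy-or-avoiding M c E xs _ | no ∄x =
    inj₂ (xs , ⊆-refl , m≤m+n _ _ , universal (λ _ y y∈E _ → ∄x (y , y∈E)) xs)
  heavy-or-avoiding M zero E xs ∣E∣≤0 | yes (x , x∈E) = ⊥-elim (n≮0 (≤-trans (x∈p⇒∣p-x∣<∣p∣ x∈E) ∣E∣≤0))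
  heavy-or-avoiding M (suc c) E xs ∣E∣≤1+c | yes (x , x∈E)
    with heavy-or-avoiding M c (E - x) xs (≤-pred (≤-trans (x∈p⇒∣p-x∣<∣p∣ x∈E) ∣E∣≤1+c))
  ... | inj₁ h = inj₁ (Heavy-mono (p─q⊆p E ⁅ x ⁆) ⊆-refl h)
  ... | inj₂ (ys , ys⊆xs , pruned , disjoint) with M ≤? length (filter (contains? x) ys)
  ...   | yes many = inj₁ (heavy x x∈E _ (⊆-trans (filter-⊆ (contains? x) ys) ys⊆xs) many
                                (all-filter (contains? x) ys))
  ...   | no  few  = inj₂ (kept , ⊆-trans (filter-⊆ avoids? ys) ys⊆xs , bound , kept-disjoint)
    where
    open ≤-Reasoning
    avoids? = ∁? (contains? x)
    kept = filter avoids? ys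
    a = length (filter (contains? x) ys)
    b = length kept
    kept-disjoint : All (Disjoint E ∘ F) kept
    kept-disjoint = All.zipWith (uncurry Disjoint-remove⁻)
                                (all-filter avoids? ys , filter⁺ avoids? disjoint)
    bound : length xs ≤ b + (M + c * M)
    bound = begin
      length xs           ≤⟨ pruned ⟩
      length ys + c * M   ≡⟨ cong (_+ c * M) (sym (length-filter-∁ (contains? x) ys)) ⟩
      a + b + c * M       ≤⟨ +-monoˡ-≤ (c * M) (+-monoˡ-≤ b (<⇒≤ (≰⇒> few))) ⟩
      M + b + c * M       ≡⟨ cong (_+ c * M) (+-comm M b) ⟩
      b + M + c * M       ≡⟨ +-assoc b M (c * M) ⟩
      b + (M + c * M)     ∎

  -- Keep the first set a; each of the at most S points of F a outside C is either heavy or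
  -- lies in fewer than M further sets, and discarding those leaves sets meeting F a in C.
  heavy-or-sunflower-with-core : ∀ C M k xs → All (λ i → C ⊆ F i) xs → k * (1 + S * M) ≤ length xs →
                                 Heavy (∁ C) M xs ⊎
                                 ∃[ ys ] ys ⊆ₗ xs × k ≤ length ys × IsSunflower C ys
  heavy-or-sunflower-with-core C M zero xs _ _ = inj₂ ([] , minimum xs , z≤n , [])
  heavy-or-sunflower-with-core C M (suc k) (a ∷ xs) (C⊆a ∷ C⊆xs) long
    with heavy-or-avoiding M S (F a ∩ ∁ C) xs (≤-trans (∣p∩q∣≤∣p∣ (F a) (∁ C)) (∣F∣≤S a))
  ... | inj₁ h = inj₁ (Heavy-mono (p∩q⊆q (F a) (∁ C)) (a ∷ʳ ⊆-refl) h)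
  ... | inj₂ (ys , ys⊆xs , pruned , disjoint)
    with heavy-or-sunflower-with-core C M k ys (All-resp-⊆ ys⊆xs C⊆xs)
                                      (m+n≤o≤p+m⇒n≤p (S * M) (s≤s⁻¹ long) pruned)
  ...   | inj₁ h = inj₁ (Heavy-mono id (a ∷ʳ ys⊆xs) h)
  ...   | inj₂ (zs , zs⊆ys , k≤ , sunflower) =
    inj₂ (a ∷ zs , refl ∷ ⊆-trans zs⊆ys ys⊆xs , s≤s k≤ , meets-a ∷ sunflower)
    where
    meets-a : All (λ z → F a ∩ F z ≡ C) zs
    meets-a = All-resp-⊆ zs⊆ys
      (All.zipWith (uncurry (p∩q≡c C⊆a)) (All-resp-⊆ ys⊆xs C⊆xs , disjoint))

  no-point-outside-full-core : ∀ {C xs} → S ≤ ∣ C ∣ → All (λ i → C ⊆ F i) xs → ¬ Heavy (∁ C) 1 xs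
  no-point-outside-full-core S≤∣C∣ C⊆xs (heavy x x∈∁C (z ∷ _) z∷zs⊆xs _ (x∈z ∷ _)) =
    <⇒≱ (p⊂q⇒∣p∣<∣q∣ (C⊆z , x , x∈z , x∈∁p⇒x∉p x∈∁C)) (≤-trans (∣F∣≤S z) S≤∣C∣)
    where
    C⊆z = All.head (All-resp-⊆ z∷zs⊆xs C⊆xs)

  sunflower-above : ∀ n t C xs → S ≤ ∣ C ∣ + t → All (λ i → C ⊆ F i) xs →
                    sunflowerBound S n t ≤ length xs → HasSunflower n xs
  sunflower-above n t C xs S≤ C⊆xs long
    with heavy-or-sunflower-with-core C (heavyThreshold S n t) n xs C⊆xs long
  ... | inj₂ (ys , ys⊆xs , n≤ , sunflower) = ys , ys⊆xs , n≤ , C , sunflower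
  sunflower-above n zero C xs S≤ C⊆xs long | inj₁ h =
    ⊥-elim (no-point-outside-full-core (subst (S ≤_) (+-identityʳ ∣ C ∣) S≤) C⊆xs h)
  sunflower-above n (suc t) C xs S≤ C⊆xs long | inj₁ (heavy x x∈∁C zs zs⊆xs many x∈zs)
    with sunflower-above n t (C ∪ ⁅ x ⁆) zs S≤∣C∪x∣+t C∪x⊆zs many
    where
    S≤∣C∪x∣+t : S ≤ ∣ C ∪ ⁅ x ⁆ ∣ + t
    S≤∣C∪x∣+t = ≤-trans S≤ (≤-trans (≤-reflexive (+-suc ∣ C ∣ t))
                                      (+-monoˡ-≤ t (∣p∣<∣p∪⁅x⁆∣ (x∈∁p⇒x∉p x∈∁C))))
    C∪x⊆zs : All (λ i → C ∪ ⁅ x ⁆ ⊆ F i) zs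
    C∪x⊆zs = All.zipWith (uncurry c∪⁅x⁆⊆p) (All-resp-⊆ zs⊆xs C⊆xs , x∈zs)
  ... | ys , ys⊆zs , n≤ , U , sunflower = ys , ⊆-trans ys⊆zs zs⊆xs , n≤ , U , sunflower

  sunflower : ∀ n xs → sunflowerBound S n S ≤ length xs → HasSunflower n xs
  sunflower n xs = sunflower-above n S ⊥ xs (≤-reflexive (cong (_+ S) (sym (∣⊥∣≡0 V))))
                                   (universal (λ i {x} → ⊥⊆ {p = F i} {x}) xs)

InRange : ℕ → ℕ → ℕ → Set
InRange lo hi m = lo ≤ m × m < hi

InRange-mono : ∀ {lo lo′ hi′ hi m} → lo ≤ lo′ → hi′ ≤ hi → InRange lo′ hi′ m → InRange lo hi m
InRange-mono lo≤lo′ hi′≤hi (lo′≤m , m<hi′) = ≤-trans lo≤lo′ lo′≤m , <-≤-trans m<hi′ hi′≤hi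

first-block≤ : ∀ lo L c → lo + L ≤ lo + suc c * L
first-block≤ lo L c = +-monoʳ-≤ lo (m≤m+n L (c * L))

module _ {P : ℕ → Set} (P? : Decidable P) where

  gap-or-hits : ∀ c L lo →
    (∃[ lo′ ] lo ≤ lo′ × lo′ + L ≤ lo + c * L × (∀ {m} → InRange lo′ (lo′ + L) m → ¬ P m))
    ⊎ (∃[ ps ] c ≤ length ps × AllPairs _<_ ps × All (λ m → InRange lo (lo + c * L) m × P m) ps)
  gap-or-hits zero L lo = inj₂ ([] , z≤n , [] , [])
  gap-or-hits (suc c) L lo with anyUpTo? (λ m → lo ≤? m ×-dec P? m) (lo + L)
  ... | no none = inj₁ (lo , ≤-refl , first-block≤ lo L c , λ (lo≤m , m<) Pm → none (_ , m< , lo≤m , Pm))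
  ... | yes (p , p<lo+L , lo≤p , Pp) with gap-or-hits c L (lo + L)
  ...   | inj₁ (lo′ , lo+L≤lo′ , end , none) =
    inj₁ (lo′ , ≤-trans (m≤m+n lo L) lo+L≤lo′ , ≤-trans end (≤-reflexive (+-assoc lo L (c * L))) , none)
  ...   | inj₂ (ps , c≤ , increasing , hits) =
    inj₂ (p ∷ ps , s≤s c≤ , All.map p<q hits ∷ increasing , (p∈ , Pp) ∷ All.map (map₁ q∈) hits)
    where
    p<q : ∀ {q} → InRange (lo + L) (lo + L + c * L) q × P q → p < q
    p<q ((lo+L≤q , _) , _) = <-≤-trans p<lo+L lo+L≤q
    p∈ : InRange lo (lo + suc c * L) p
    p∈ = lo≤p , <-≤-trans p<lo+L (first-block≤ lo L c)
    q∈ : ∀ {q} → InRange (lo + L) (lo + L + c * L) q → InRange lo (lo + suc c * L) q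
    q∈ = InRange-mono (m≤m+n lo L) (≤-reflexive (+-assoc lo L (c * L)))

windowLength : (S N d : ℕ) → ℕ
windowLength S N d = sunflowerBound S N S ^ d

module Levels {V : ℕ} (B : ℕ → Subset V) (S : ℕ) (∣B∣≤S : ∀ k → ∣ B k ∣ ≤ S) (N : ℕ) where

  open Sunflowers B S ∣B∣≤S using (IsSunflower; sunflower)

  Floor : ℕ → ℕ → ℕ → Set
  Floor b lo hi = ∀ {m} → InRange lo hi m → b ≤ ∣ B m ∣

  record LevelledSunflower : Set where
    field
      size from to : ℕ
      floor       : Floor size from to
      positions   : List ℕ
      enough      : N ≤ length positions
      increasing  : AllPairs _<_ positions
      inside      : All (InRange from to) positions
      levelled    : All (λ k → ∣ B k ∣ ≡ size) positions
      core        : Subset V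
      isSunflower : IsSunflower core positions

  open LevelledSunflower

  LevelledSunflowerWithin : ℕ → ℕ → Set
  LevelledSunflowerWithin lo hi = ∃[ L ] lo ≤ from L × to L ≤ hi

  widen : ∀ {lo lo′ hi′ hi} → lo ≤ lo′ → hi′ ≤ hi →
          LevelledSunflowerWithin lo′ hi′ → LevelledSunflowerWithin lo hi
  widen lo≤lo′ hi′≤hi (L , lo′≤from , to≤hi′) = L , ≤-trans lo≤lo′ lo′≤from , ≤-trans to≤hi′ hi′≤hi

  levelledSunflower-above-floor : ∀ d b lo → S < b + d → Floor b lo (lo + windowLength S N d) →
                                  LevelledSunflowerWithin lo (lo + windowLength S N d)
  levelledSunflower-above-floor zero b lo S<b+0 floor-b =
    ⊥-elim (<⇒≱ S<b+0 (≤-trans (≤-reflexive (+-identityʳ b))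
                               (≤-trans (floor-b (≤-refl , m<m+n lo z<s)) (∣B∣≤S lo))))
  levelledSunflower-above-floor (suc d) b lo S<b+1+d floor-b
    with gap-or-hits (λ m → ∣ B m ∣ ≟ b) (sunflowerBound S N S) (windowLength S N d) lo
  ... | inj₁ (lo′ , lo≤lo′ , end , none-at-b) =
    widen lo≤lo′ end
      (levelledSunflower-above-floor d (suc b) lo′ (subst (S <_) (+-suc b d) S<b+1+d) floor-1+b)
    where
    floor-1+b : Floor (suc b) lo′ (lo′ + windowLength S N d)
    floor-1+b m∈ = ≤∧≢⇒< (floor-b (InRange-mono lo≤lo′ end m∈)) (none-at-b m∈ ∘ sym)
  ... | inj₂ (ps , enough-hits , increasing-hits , hits)
    with sunflower N ps enough-hits
  ...   | ys , ys⊆ps , N≤ , U , flower = L , ≤-refl , ≤-refl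
    where
    L : LevelledSunflower
    L = record
      { size = b ; from = lo ; to = lo + windowLength S N (suc d) ; floor = floor-b
      ; positions = ys ; enough = N≤
      ; increasing = AllPairs-resp-⊆ ys⊆ps increasing-hits
      ; inside = All-resp-⊆ ys⊆ps (All.map proj₁ hits)
      ; levelled = All-resp-⊆ ys⊆ps (All.map proj₂ hits)
      ; core = U ; isSunflower = flower }

  levelledSunflower : ∀ lo → LevelledSunflowerWithin lo (lo + windowLength S N (suc S))
  levelledSunflower lo = levelledSunflower-above-floor (suc S) 0 lo ≤-refl (λ _ → z≤n)

  size≤S : 1 ≤ N → (L : LevelledSunflower) → size L ≤ S
  size≤S 1≤N L = level≤S (≤-trans 1≤N (enough L)) (levelled L)
    where
    level≤S : ∀ {ks} → 1 ≤ length ks → All (λ k → ∣ B k ∣ ≡ size L) ks → size L ≤ S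
    level≤S {k ∷ _} _ (∣Bk∣≡s ∷ _) = subst (_≤ S) ∣Bk∣≡s (∣B∣≤S k)

  1≤size : ∀ {hi} → (∀ {p q} → p < q → q < hi → B p ≢ B q) → 2 ≤ N →
           (L : LevelledSunflower) → to L ≤ hi → 1 ≤ size L
  1≤size distinct 2≤N L to≤hi =
    n≢0⇒n>0 (two-empty (≤-trans 2≤N (enough L)) (increasing L) (inside L) (levelled L))
    where
    two-empty : ∀ {ks} → 2 ≤ length ks → AllPairs _<_ ks → All (InRange (from L) (to L)) ks →
                All (λ k → ∣ B k ∣ ≡ size L) ks → size L ≢ 0
    two-empty {_ ∷ []} (s≤s ())
    two-empty {p ∷ q ∷ _} _ ((p<q ∷ _) ∷ _) (_ ∷ (_ , q<to) ∷ _) (∣Bp∣≡s ∷ ∣Bq∣≡s ∷ _) s≡0 =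
      distinct p<q (<-≤-trans q<to to≤hi)
        (trans (∣p∣≡0⇒p≡⊥ (trans ∣Bp∣≡s s≡0)) (sym (∣p∣≡0⇒p≡⊥ (trans ∣Bq∣≡s s≡0))))

module PathBags {G T : Graph} (Y : Bags G T) (P : Path T) where

  -- Positions past the end of P get the empty bag; no window used below reaches them.
  bagAt : ℕ → Subset (nV G)
  bagAt k with k <? length (verts P)
  ... | yes k<∣P∣ = Y (at P (fromℕ< k<∣P∣))
  ... | no  _     = ⊥

  bagAt-fromℕ< : ∀ {k} (k<∣P∣ : k < length (verts P)) → bagAt k ≡ Y (at P (fromℕ< k<∣P∣))
  bagAt-fromℕ< {k} k<∣P∣ with k <? length (verts P)
  ... | yes _  = refl
  ... | no  k≮ = contradiction k<∣P∣ k≮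

  bagAt-toℕ : ∀ m → bagAt (toℕ m) ≡ Y (at P m)
  bagAt-toℕ m = trans (bagAt-fromℕ< (toℕ<n m)) (cong (Y ∘ at P) (fromℕ<-toℕ m (toℕ<n m)))

  ∣bagAt∣≤ : ∀ {w} → WidthAtMost G T Y w → ∀ k → ∣ bagAt k ∣ ≤ suc w
  ∣bagAt∣≤ width k with k <? length (verts P)
  ... | yes _ = width _
  ... | no  _ = subst (_≤ _) (sym (∣⊥∣≡0 (nV G))) z≤n

  bagAt-distinct : W4 G T Y → ∀ {p q} → p < q → q < length (verts P) → bagAt p ≢ bagAt q
  bagAt-distinct distinct-bags p<q q<∣P∣ bagAt-p≡bagAt-q =
    distinct-bags (at P (fromℕ< p<∣P∣)) (at P (fromℕ< q<∣P∣))
      (AllPairs-lookup (unique P) (fromℕ< p<∣P∣) (fromℕ< q<∣P∣)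
        (subst₂ _<_ (sym (toℕ-fromℕ< p<∣P∣)) (sym (toℕ-fromℕ< q<∣P∣)) p<q))
      (trans (sym (bagAt-fromℕ< p<∣P∣)) (trans bagAt-p≡bagAt-q (bagAt-fromℕ< q<∣P∣)))
    where
    p<∣P∣ = <-trans p<q q<∣P∣

  module _ {w : ℕ} (width : WidthAtMost G T Y w) (n : ℕ) where

    open Levels bagAt (suc w) (∣bagAt∣≤ width) (suc n)
    open LevelledSunflower

    conclusion : ∀ (L : LevelledSunflower) → 1 ≤ from L → to L ≤ pathLength P →
                 1 ≤ size L → size L ≤ suc w → Lemma5p4Conclusion G T Y P n w
    conclusion L 1≤from to≤ℓ 1≤s s≤1+w =
      σ , σ-increasing , σ-interior , (size L , 1≤s , s≤1+w , σ-size , σ-floor) , core L , σ-sunflower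
      where
      index : Fin n → Fin (length (positions L))
      index i = inject≤ i (≤-trans (n≤1+n n) (enough L))

      toℕ-index : ∀ i → toℕ (index i) ≡ toℕ i
      toℕ-index i = toℕ-inject≤ i _

      pos : Fin n → ℕ
      pos i = lookup (positions L) (index i)

      pos-inside : ∀ i → InRange (from L) (to L) (pos i)
      pos-inside i = All.lookup (inside L) (∈-lookup (index i))

      pos<∣P∣ : ∀ i → pos i < length (verts P)
      pos<∣P∣ i = <-≤-trans (proj₂ (pos-inside i)) (≤-trans to≤ℓ (n≤1+n _))

      σ : Fin n → Fin (length (verts P))
      σ i = fromℕ< (pos<∣P∣ i)

      toℕ-σ : ∀ i → toℕ (σ i) ≡ pos i
      toℕ-σ i = toℕ-fromℕ< (pos<∣P∣ i)

      bag-σ : ∀ i → Y (at P (σ i)) ≡ bagAt (pos i)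
      bag-σ i = sym (bagAt-fromℕ< (pos<∣P∣ i))

      σ-increasing : ∀ i j → toℕ i < toℕ j → toℕ (σ i) < toℕ (σ j)
      σ-increasing i j i<j = subst₂ _<_ (sym (toℕ-σ i)) (sym (toℕ-σ j))
        (AllPairs-lookup (increasing L) (index i) (index j)
          (subst₂ _<_ (sym (toℕ-index i)) (sym (toℕ-index j)) i<j))

      σ-interior : ∀ i → (0 < toℕ (σ i)) × (toℕ (σ i) < pathLength P)
      σ-interior i = subst (0 <_) (sym (toℕ-σ i)) (≤-trans 1≤from (proj₁ (pos-inside i)))
                   , subst (_< pathLength P) (sym (toℕ-σ i)) (<-≤-trans (proj₂ (pos-inside i)) to≤ℓ)

      σ-size : ∀ i → ∣ Y (at P (σ i)) ∣ ≡ size L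
      σ-size i = trans (cong ∣_∣ (bag-σ i)) (All.lookup (levelled L) (∈-lookup (index i)))

      σ-floor : ∀ m → (∃[ i ] ∃[ j ] toℕ (σ i) ≤ toℕ m × toℕ m ≤ toℕ (σ j)) → size L ≤ ∣ Y (at P m) ∣
      σ-floor m (i , j , σi≤m , m≤σj) = subst (size L ≤_) (cong ∣_∣ (bagAt-toℕ m))
        (floor L ( ≤-trans (proj₁ (pos-inside i)) (subst (_≤ toℕ m) (toℕ-σ i) σi≤m)
                 , ≤-<-trans (subst (toℕ m ≤_) (toℕ-σ j) m≤σj) (proj₂ (pos-inside j)) ))

      σ-sunflower : ∀ i j → i ≢ j → Y (at P (σ i)) ∩ Y (at P (σ j)) ≡ core L
      σ-sunflower i j i≢j = trans (cong₂ _∩_ (bag-σ i) (bag-σ j))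
        (AllPairs-lookup-≢ (λ {a} {b} eq → trans (∩-comm (bagAt b) (bagAt a)) eq) (isSunflower L)
          (index i) (index j)
          (λ eq → i≢j (toℕ-injective (trans (sym (toℕ-index i)) (trans (cong toℕ eq) (toℕ-index j))))))

lemma5p4 : Σ (ℕ → ℕ → ℕ) λ f →
    ∀ (n w : ℕ) → 1 ≤ n → 1 ≤ w →
    (G T : Graph) (Y : Bags G T) →
    Connected G → IsLean G T Y → WidthAtMost G T Y w →
    (P : Path T) → f n w ≤ pathLength P →
    Lemma5p4Conclusion G T Y P n w
lemma5p4 = (λ n w → suc (windowLength (suc w) (suc n) (suc (suc w))))
         , λ n w 1≤n _ G T Y _ (_ , _ , distinct-bags , _) width P long →
  let open PathBags {G} {T} Y P
      open Levels bagAt (suc w) (∣bagAt∣≤ width) (suc n)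
      (L , 1≤from , to≤hi) = levelledSunflower 1
      to≤ℓ = ≤-trans to≤hi long
      distinct : ∀ {p q} → p < q → q < pathLength P → bagAt p ≢ bagAt q
      distinct p<q q<ℓ = bagAt-distinct distinct-bags p<q (≤-trans q<ℓ (n≤1+n _))
  in conclusion width n L 1≤from to≤ℓ (1≤size distinct (s≤s 1≤n) L to≤ℓ) (size≤S (s≤s z≤n) L)
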